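{- Let $H$ be a connected bigraph. Every directed path in the condensation of $H^+$ has at most three vertices.
   Context: A bigraph is a bipartite graph $H$ with a fixed bipartition $V(H)=B\cup W$; two vertices have the same colour if they lie in the same part. The pair-digraph $H^+$ has as vertices all ordered pairs $(u,v)$ of distinct vertices of $H$, and arcs: $(u,v)\to(u',v)$ whenever $u,v$ have the same colour, $uu'\in E(H)$ and $vu'\notin E(H)$; and $(u,v)\to(u,v')$ whenever $u,v$ have different colours, $vv'\in E(H)$ and $uv\notin E(H)$. The condensation of a digraph is obtained by identifying the vertices of each strong component and deleting loops and multiple arcs. -}

module Defs where

open import Data.Nat using (ℕ)
open import Data.Fin using (Fin)
open import Data.Bool using (Bool; true; false; T)
open import Data.Product using (Σ; ∃; ∃-syntax; _×_; _,_; proj₁; proj₂)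
open import Data.List using (List; length)
open import Data.List.Relation.Unary.Linked using (Linked)
open import Data.List.Relation.Unary.AllPairs using (AllPairs)
open import Relation.Binary.PropositionalEquality using (_≡_; _≢_)
open import Relation.Binary.Construct.Closure.ReflexiveTransitive using (Star)
open import Relation.Nullary using (¬_)

-- A finite bigraph on vertex set Fin n: a colouring (the fixed bipartition
-- B = colour false, W = colour true) and a symmetric adjacency relation in
-- which every edge joins vertices of different colours (hence no loops).
record Bigraph : Set where
  field
    n       : ℕ
    colour  : Fin n → Bool
    adj     : Fin n → Fin n → Bool
    adj-sym : ∀ u v → adj u v ≡ adj v u
    bip     : ∀ u v → T (adj u v) → colour u ≢ colour v

module _ (H : Bigraph) where
  open Bigraph H

  Edge : Fin n → Fin n → Set
  Edge u v = T (adj u v)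

  SameColour : Fin n → Fin n → Set
  SameColour u v = colour u ≡ colour v

  Connected : Set
  Connected = ∀ u v → Star Edge u v

  PairVertex : Set
  PairVertex = Σ (Fin n × Fin n) (λ p → proj₁ p ≢ proj₂ p)

  fst snd : PairVertex → Fin n
  fst p = proj₁ (proj₁ p)
  snd p = proj₂ (proj₁ p)

  data Arc : PairVertex → PairVertex → Set where
    moveFst : ∀ {p q} → snd q ≡ snd p → SameColour (fst p) (snd p)
            → Edge (fst p) (fst q) → ¬ Edge (snd p) (fst q) → Arc p q
    moveSnd : ∀ {p q} → fst q ≡ fst p → ¬ SameColour (fst p) (snd p)
            → Edge (snd p) (snd q) → ¬ Edge (fst p) (snd p) → Arc p q

  Reach : PairVertex → PairVertex → Set
  Reach = Star Arc

  SameComp : PairVertex → PairVertex → Set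
  SameComp p q = Reach p q × Reach q p

  -- Arc of the condensation between the strong components of p and q
  -- (components represented by any of their members): distinct components,
  -- and some arc of H⁺ from the first to the second.
  CondArc : PairVertex → PairVertex → Set
  CondArc p q = ¬ SameComp p q × ∃[ a ] ∃[ b ] (SameComp p a × Arc a b × SameComp b q)

  -- A directed path in the condensation, given as the list of its vertices
  -- (each component represented by a member): consecutive components joined
  -- by arcs of the condensation, all components pairwise distinct.
  CondPath : List PairVertex → Set
  CondPath ps = Linked CondArc ps × AllPairs (λ p q → ¬ SameComp p q) ps

module Submission where

-- Call a pair (u,v) of H⁺ monochromatic when u and v have the
-- same colour.  Arcs moving the first coordinate leave monochromatic pairs and
-- (since they follow an edge of H) enter bichromatic ones; arcs moving the
-- second coordinate leave bichromatic pairs and enter monochromatic ones.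
-- Hence a two-arc walk p → q → r through a monochromatic q always has the
-- shape (u,x) → (u,v) → (u',v), and the arcs (u',v) → (u',x) → (u,x) close it
-- into a directed 4-cycle.  Consequently every arc a → b of H⁺ such that a is
-- entered by some arc and b is left by some arc lies on a cycle, i.e. a and b
-- are in the same strong component.  In a path of four strong components the
-- middle arc of the condensation is realised by such an arc of H⁺, which is
-- impossible; so condensation paths have at most three vertices.  The
-- argument is local and does not need H to be connected.

open import Defs
open import Data.Nat using (_≤_; z≤n; s≤s)
open import Data.List using (List; length; []; _∷_)
open import Data.Bool using (Bool; T)
open import Data.Bool.Properties using (¬-not)
open import Data.Product using (∃; _,_)
open import Data.Empty using (⊥; ⊥-elim)
open import Data.List.Relation.Unary.Linked using (_∷_)
open import Relation.Nullary using (¬_)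
open import Relation.Binary.PropositionalEquality using (_≡_; _≢_; refl; sym; trans; cong; subst)
open import Relation.Binary.Construct.Closure.ReflexiveTransitive using (ε; _◅_; _◅◅_)

two-colours : {a b c : Bool} → a ≢ b → c ≢ b → a ≡ c
two-colours a≢b c≢b = trans (¬-not a≢b) (sym (¬-not c≢b))

module PairDigraph (H : Bigraph) where
  open Bigraph H

  edge-sym : ∀ {u v} → Edge H u v → Edge H v u
  edge-sym {u} {v} = subst T (adj-sym u v)

  Mono : PairVertex H → Set
  Mono p = SameColour H (fst H p) (snd H p)

  moveFst-target : ∀ {p q} → snd H q ≡ snd H p → Mono p
                 → Edge H (fst H p) (fst H q) → ¬ Mono q
  moveFst-target {p} {q} q₂≡p₂ mono-p p₁~q₁ mono-q =
    bip (fst H p) (fst H q) p₁~q₁ (trans mono-p (trans (cong colour (sym q₂≡p₂)) (sym mono-q)))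

  moveSnd-target : ∀ {p q} → fst H q ≡ fst H p → ¬ Mono p
                 → Edge H (snd H p) (snd H q) → Mono q
  moveSnd-target {p} {q} q₁≡p₁ bichr-p p₂~q₂ =
    trans (cong colour q₁≡p₁) (two-colours bichr-p (λ c → bip (snd H p) (snd H q) p₂~q₂ (sym c)))

  -- A two-arc walk p → q → r through a monochromatic pair q closes into a
  -- 4-cycle: with p = (u,x), q = (u,v), r = (u',v) we return via (u',x).
  close-square : ∀ {p q r} → Arc H p q → Arc H q r → Mono q → Reach H r p
  close-square {p} {q} (moveFst q₂≡p₂ mono-p p₁~q₁ _) _ mono-q =
    ⊥-elim (moveFst-target {p} {q} q₂≡p₂ mono-p p₁~q₁ mono-q)
  close-square _ (moveSnd _ bichr-q _ _) mono-q = ⊥-elim (bichr-q mono-q)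
  close-square {(u , x) , u≢x} {(.u , v) , _} {(u' , .v) , _}
               (moveSnd refl u≄x x~v u≁x) (moveFst refl u≃v u~u' v≁u') _ =
    moveSnd {q = (u' , x) , u'≢x} refl u'≄v (edge-sym x~v) (λ u'~v → v≁u' (edge-sym u'~v))
    ◅ moveFst {q = (u , x) , u≢x} refl u'≃x (edge-sym u~u') (λ x~u → u≁x (edge-sym x~u))
    ◅ ε
    where
      u≄u' : colour u ≢ colour u'
      u≄u' = bip u u' u~u'
      u'≄v : colour u' ≢ colour v
      u'≄v c = u≄u' (trans u≃v (sym c))
      u'≃x : colour u' ≡ colour x
      u'≃x = two-colours (λ c → u≄u' (sym c)) (λ c → u≄x (sym c))
      u'≢x : u' ≢ x
      u'≢x refl = u≁x u~u'

  InArc OutArc : PairVertex H → Set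
  InArc a = ∃ λ w → Arc H w a
  OutArc b = ∃ λ w → Arc H b w

  -- An arc whose tail has an in-arc and whose head has an out-arc lies on a
  -- cycle: the monochromatic end of the arc is the middle of a closing square.
  arc-on-cycle : ∀ {a b} → Arc H a b → InArc a → OutArc b → Reach H b a
  arc-on-cycle a→b@(moveFst _ mono-a _ _) (w , w→a) _ =
    close-square w→a a→b mono-a ◅◅ (w→a ◅ ε)
  arc-on-cycle {a} {b} a→b@(moveSnd b₁≡a₁ bichr-a a₂~b₂ _) _ (_ , b→y) =
    b→y ◅ close-square a→b b→y (moveSnd-target {a} {b} b₁≡a₁ bichr-a a₂~b₂)

  last-arc : ∀ {x y z} → Arc H x y → Reach H y z → InArc z
  last-arc x→y ε = _ , x→y
  last-arc _ (y→y' ◅ y'→*z) = last-arc y→y' y'→*z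

  first-arc : ∀ {x y z} → Reach H x y → Arc H y z → OutArc x
  first-arc ε y→z = _ , y→z
  first-arc (x→x' ◅ _) _ = _ , x→x'

  -- The condensation has no directed path with three arcs: its middle arc is
  -- realised by an arc of H⁺ lying on a cycle, merging its two components.
  no-three-condensation-arcs : ∀ {p₁ p₂ p₃ p₄} → CondArc H p₁ p₂ → CondArc H p₂ p₃
                             → CondArc H p₃ p₄ → ⊥
  no-three-condensation-arcs (_ , _ , _ , _ , a'→b' , (b'→*p₂ , _))
                             (p₂≁p₃ , a , b , (p₂→*a , a→*p₂) , a→b , (b→*p₃ , p₃→*b))
                             (_ , _ , _ , (p₃→*a'' , _) , a''→b'' , _) =
    p₂≁p₃ (p₂→*a ◅◅ (a→b ◅ b→*p₃) , p₃→*b ◅◅ (b→*a ◅◅ a→*p₂))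
    where
      b→*a : Reach H b a
      b→*a = arc-on-cycle a→b (last-arc a'→b' (b'→*p₂ ◅◅ p₂→*a))
                              (first-arc (b→*p₃ ◅◅ p₃→*a'') a''→b'')

lemma2p8 : (H : Bigraph) → Connected H → (ps : List (PairVertex H)) → CondPath H ps → length ps ≤ 3
lemma2p8 H _ [] _ = z≤n
lemma2p8 H _ (_ ∷ []) _ = s≤s z≤n
lemma2p8 H _ (_ ∷ _ ∷ []) _ = s≤s (s≤s z≤n)
lemma2p8 H _ (_ ∷ _ ∷ _ ∷ []) _ = s≤s (s≤s (s≤s z≤n))
lemma2p8 H _ (_ ∷ _ ∷ _ ∷ _ ∷ _) (c₁₂ ∷ c₂₃ ∷ c₃₄ ∷ _ , _) =
  ⊥-elim (PairDigraph.no-three-condensation-arcs H c₁₂ c₂₃ c₃₄)
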